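{- Let $S\subseteq\mathbb{Z}^+$ be such that $S-1=\{s-1:s\in S\}$ is an additive monoid (i.e. $0\in S-1$ and $S-1$ is closed under addition). Then: (1) if $t\ge1$ and $s_1,\dots,s_t$ and $t$ are all elements of $S$, then $s_1+\cdots+s_t\in S$; (2) if $t\in S$ and $s_1,\dots,s_{t-1}\in S$, then $s_1+\cdots+s_{t-1}\in S-1$.
   Context: Such a set $S$ is called a $^+1$ monoid. -}

module Defs where

open import Data.Nat using (ℕ; zero; suc; _+_; _≤_; _∸_)
open import Data.Fin using (Fin)
open import Data.Vec.Functional using (foldr)

-- A subset S ⊆ ℤ⁺ is represented as a predicate on ℕ all of whose members are ≥ 1.
-- Membership of m in S - 1 = {s - 1 : s ∈ S} (for m ∈ ℕ) is S (suc m).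
_∈S-1 : ℕ → (ℕ → Set) → Set
(m ∈S-1) S = S (suc m)

record IsPlusOneMonoid (S : ℕ → Set) : Set where
  field
    positive : ∀ s → S s → 1 ≤ s
    zero∈    : (0 ∈S-1) S
    closed   : ∀ a b → (a ∈S-1) S → (b ∈S-1) S → ((a + b) ∈S-1) S

Σ : ∀ {t} → (Fin t → ℕ) → ℕ
Σ s = foldr _+_ 0 s

module Submission where

-- Every s ∈ S is 1 + a with a ∈ S − 1, so a sum of k elements of S is k plus a sum of
-- elements of the monoid S − 1, i.e. k + a with a ∈ S − 1.  For t = 1 + b ∈ S, adding b ∈ S − 1
-- then gives s₁ + ⋯ + sₜ = 1 + (b + a) ∈ S and s₁ + ⋯ + s_{t−1} = b + a ∈ S − 1.

open import Defs
open import Data.Nat using (ℕ; zero; suc; _+_; _≤_; _∸_; pred; s≤s)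
open import Data.Nat.Properties using (+-commutativeSemigroup)
open import Data.Fin using (Fin; zero; suc)
open import Data.Product using (_×_; _,_)
open import Function using (_∘_)
open import Relation.Binary.PropositionalEquality
open import Algebra.Properties.CommutativeSemigroup +-commutativeSemigroup using (x∙yz≈y∙xz)

Σ-pred : ∀ {k} (s : Fin k → ℕ) → (∀ i → 1 ≤ s i) → k + Σ (pred ∘ s) ≡ Σ s
Σ-pred {zero}  s positive = refl
Σ-pred {suc k} s positive with s zero | positive zero
... | suc a | s≤s _ = cong suc (begin
  k + (a + Σ (pred ∘ s ∘ suc))  ≡⟨ x∙yz≈y∙xz k a _ ⟩
  a + (k + Σ (pred ∘ s ∘ suc))  ≡⟨ cong (a +_) (Σ-pred (s ∘ suc) (positive ∘ suc)) ⟩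
  a + Σ (s ∘ suc)               ∎)
  where open ≡-Reasoning

module _ {S : ℕ → Set} (M : IsPlusOneMonoid S) where
  open IsPlusOneMonoid M

  pred∈S-1 : ∀ {x} → S x → (pred x ∈S-1) S
  pred∈S-1 {zero}  x∈S with positive zero x∈S
  ... | ()
  pred∈S-1 {suc x} x∈S = x∈S

  Σ∈S-1 : ∀ {k} (a : Fin k → ℕ) → (∀ i → (a i ∈S-1) S) → (Σ a ∈S-1) S
  Σ∈S-1 {zero}  a a∈ = zero∈
  Σ∈S-1 {suc k} a a∈ = closed _ _ (a∈ zero) (Σ∈S-1 (a ∘ suc) (a∈ ∘ suc))

  Σ≡k+Σpred : ∀ {k} (s : Fin k → ℕ) → (∀ i → S (s i)) → k + Σ (pred ∘ s) ≡ Σ s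
  Σ≡k+Σpred s s∈ = Σ-pred s (λ i → positive (s i) (s∈ i))

  Σpred∈S-1 : ∀ {k} (s : Fin k → ℕ) → (∀ i → S (s i)) → (Σ (pred ∘ s) ∈S-1) S
  Σpred∈S-1 s s∈ = Σ∈S-1 (pred ∘ s) (pred∈S-1 ∘ s∈)

mainTheorem10 : (S : ℕ → Set) → IsPlusOneMonoid S →
    ((t : ℕ) → 1 ≤ t → S t → (s : Fin t → ℕ) → (∀ i → S (s i)) → S (Σ s))
    × ((t : ℕ) → S t → (s : Fin (t ∸ 1) → ℕ) → (∀ i → S (s i)) → ((Σ s) ∈S-1) S)
mainTheorem10 S M = sum-of-t , sum-of-t-1
  where
  open IsPlusOneMonoid M

  sum-of-t : (t : ℕ) → 1 ≤ t → S t → (s : Fin t → ℕ) → (∀ i → S (s i)) → S (Σ s)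
  sum-of-t (suc b) _ t∈S s s∈ =
    subst S (Σ≡k+Σpred M s s∈) (closed b _ t∈S (Σpred∈S-1 M s s∈))

  sum-of-t-1 : (t : ℕ) → S t → (s : Fin (t ∸ 1) → ℕ) → (∀ i → S (s i)) → (Σ s ∈S-1) S
  sum-of-t-1 zero    t∈S with positive zero t∈S
  ... | ()
  sum-of-t-1 (suc b) t∈S s s∈ =
    subst (λ x → (x ∈S-1) S) (Σ≡k+Σpred M s s∈) (closed b _ t∈S (Σpred∈S-1 M s s∈))
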